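{- Let $r\ge 2$, let $R$ and $S$ be rings with unity with $R$ an $S$-module, let $\vec\lambda=(\lambda_1,\dots,\lambda_r)\in S^r$, and let $R'\subseteq R$ and $A\subseteq R$ be finite. Suppose that for all $i_1\neq i_2$ in $\{1,\dots,r\}$ and all $a_1,a_2\in A$, the equation $(\lambda_{i_2}-\lambda_{i_1})a_1=(\lambda_{i_2}-\lambda_{i_1})a_2$ implies $a_1=a_2$. Then $\mathcal{H}(A,\vec\lambda)$ has no Berge $2$-cycle.
   Context: $\mathcal{H}(A,\vec\lambda)$ is the $r$-uniform $r$-partite hypergraph whose vertices are pairs $(y,i)$ with $y\in R$, $i\in\{1,\dots,r\}$ (the $i$-th part being $R'\times\{i\}$), and whose edge set is $\{e(x,a): x\in R', a\in A\}$, where $e(x,a)=\{(x+\lambda_1 a,1),(x+\lambda_2 a,2),\dots,(x+\lambda_r a,r)\}$. A Berge $2$-cycle consists of two distinct vertices $v_1,v_2$ and two distinct edges $E_1,E_2$ with $\{v_1,v_2\}\subseteq E_1\cap E_2$. -}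

module Defs where

import Data.Nat
open import Level using (Level; _⊔_)
open import Algebra.Bundles using (Ring)
open import Data.Fin using (Fin)
open import Data.List using (List)
open import Data.Product using (Σ; _×_; _,_)
open import Relation.Binary.PropositionalEquality using (_≡_)
open import Relation.Nullary using (¬_)
open import Function.Bundles using (_⇔_)
import Data.List.Membership.Setoid as SetoidMembership

-- Vertices are pairs (y , i) with y ∈ R, i ∈ Fin r (Fin r ≅ {1,…,r}).
-- The edge e(x,a) is the r-element vertex set {(x + λ_i a , i) : i}.
module Hypergraph {s ℓs c ℓ : Level}
  (S : Ring s ℓs) (R : Ring c ℓ)
  (_*ₗ_ : Ring.Carrier S → Ring.Carrier R → Ring.Carrier R)
  (r : Data.Nat.ℕ) (lam : Fin r → Ring.Carrier S)
  (R' A : List (Ring.Carrier R)) where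

  open Ring R
  open SetoidMembership setoid using (_∈_)

  Vertex : Set c
  Vertex = Carrier × Fin r

  _≈V_ : Vertex → Vertex → Set ℓ
  (y , i) ≈V (y' , i') = (y ≈ y') × (i ≡ i')

  _∈e[_,_] : Vertex → Carrier → Carrier → Set ℓ
  (y , i) ∈e[ x , a ] = y ≈ x + (lam i *ₗ a)

  SameEdge : Carrier → Carrier → Carrier → Carrier → Set (c ⊔ ℓ)
  SameEdge x a x' a' = ∀ (v : Vertex) → (v ∈e[ x , a ]) ⇔ (v ∈e[ x' , a' ])

  BergeTwoCycle : Set (c ⊔ ℓ)
  BergeTwoCycle =
    Σ Carrier λ x₁ → Σ Carrier λ a₁ → Σ Carrier λ x₂ → Σ Carrier λ a₂ →
      (x₁ ∈ R') × (a₁ ∈ A) × (x₂ ∈ R') × (a₂ ∈ A) ×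
      ¬ SameEdge x₁ a₁ x₂ a₂ ×
      Σ Vertex λ v₁ → Σ Vertex λ v₂ →
        ¬ (v₁ ≈V v₂) ×
        (v₁ ∈e[ x₁ , a₁ ]) × (v₂ ∈e[ x₁ , a₁ ]) ×
        (v₁ ∈e[ x₂ , a₂ ]) × (v₂ ∈e[ x₂ , a₂ ])

  HasNoBerge2Cycle : Set (c ⊔ ℓ)
  HasNoBerge2Cycle = ¬ BergeTwoCycle

{-# OPTIONS --safe #-}
-- If two edges e(x₁,a₁), e(x₂,a₂) share vertices in two different parts i₁ ≠ i₂,
-- then x₁ + λᵢ a₁ = x₂ + λᵢ a₂ for i = i₁, i₂; subtracting gives
-- (λ_{i₂} − λ_{i₁}) a₁ = (λ_{i₂} − λ_{i₁}) a₂, so a₁ = a₂ by hypothesis, then x₁ = x₂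
-- and the edges coincide.  Two common vertices in the same part are equal, since an
-- edge meets each part exactly once.
module Submission where

open import Defs
open import Level using (Level)
open import Algebra.Bundles using (Ring)
open import Algebra.Module.Bundles using (LeftModule)
open import Algebra.Module.Structures using (IsLeftModule)
import Algebra.Properties.Group as GroupProperties
open import Data.Nat using (ℕ; _≥_)
open import Data.Fin using (Fin; _≟_)
open import Data.List using (List)
open import Data.Product using (_,_)
open import Function.Bundles using (mk⇔)
open import Relation.Binary.PropositionalEquality using (_≡_; refl)
open import Relation.Nullary using (¬_; yes; no)
import Data.List.Membership.Setoid as SetoidMembership
import Relation.Binary.Reasoning.Setoid as SetoidReasoning

module _ {s ℓs m ℓm : Level} {S : Ring s ℓs} (M : LeftModule S m ℓm) where
  open Ring S using (_+_; -_) renaming (_≈_ to _≈ˢ_)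
  private module S = Ring S
  open LeftModule M
  open GroupProperties +ᴹ-group using (∙-cancelˡ; ∙-cancelʳ)
  open SetoidReasoning ≈ᴹ-setoid

  [τ-σ]a+σa≈τa : ∀ σ τ a → (τ + - σ) *ₗ a +ᴹ σ *ₗ a ≈ᴹ τ *ₗ a
  [τ-σ]a+σa≈τa σ τ a = ≈ᴹ-trans (≈ᴹ-sym (*ₗ-distribʳ a (τ + - σ) σ)) (*ₗ-cong τ-σ+σ≈τ ≈ᴹ-refl)
    where
    τ-σ+σ≈τ : τ + - σ + σ ≈ˢ τ
    τ-σ+σ≈τ = S.trans (S.+-assoc τ (- σ) σ)
                (S.trans (S.+-congˡ (S.-‿inverseˡ σ)) (S.+-identityʳ τ))

  coincide-twice⇒[τ-σ]a₁≈[τ-σ]a₂ : ∀ {σ τ x₁ x₂ a₁ a₂} →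
    x₁ +ᴹ σ *ₗ a₁ ≈ᴹ x₂ +ᴹ σ *ₗ a₂ → x₁ +ᴹ τ *ₗ a₁ ≈ᴹ x₂ +ᴹ τ *ₗ a₂ →
    (τ + - σ) *ₗ a₁ ≈ᴹ (τ + - σ) *ₗ a₂
  coincide-twice⇒[τ-σ]a₁≈[τ-σ]a₂ {σ} {τ} {x₁} {x₂} {a₁} {a₂} at-σ at-τ =
    ∙-cancelˡ (x₁ +ᴹ σ *ₗ a₁) _ _ (begin
      (x₁ +ᴹ σ *ₗ a₁) +ᴹ d *ₗ a₁  ≈⟨ +ᴹ-assoc x₁ _ _ ⟩
      x₁ +ᴹ (σ *ₗ a₁ +ᴹ d *ₗ a₁)  ≈⟨ +ᴹ-congˡ (+ᴹ-comm _ _) ⟩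
      x₁ +ᴹ (d *ₗ a₁ +ᴹ σ *ₗ a₁)  ≈⟨ +ᴹ-congˡ ([τ-σ]a+σa≈τa σ τ a₁) ⟩
      x₁ +ᴹ τ *ₗ a₁               ≈⟨ at-τ ⟩
      x₂ +ᴹ τ *ₗ a₂               ≈⟨ +ᴹ-congˡ ([τ-σ]a+σa≈τa σ τ a₂) ⟨
      x₂ +ᴹ (d *ₗ a₂ +ᴹ σ *ₗ a₂)  ≈⟨ +ᴹ-congˡ (+ᴹ-comm _ _) ⟩
      x₂ +ᴹ (σ *ₗ a₂ +ᴹ d *ₗ a₂)  ≈⟨ +ᴹ-assoc x₂ _ _ ⟨
      (x₂ +ᴹ σ *ₗ a₂) +ᴹ d *ₗ a₂  ≈⟨ +ᴹ-congʳ at-σ ⟨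
      (x₁ +ᴹ σ *ₗ a₁) +ᴹ d *ₗ a₂  ∎)
    where
    d : S.Carrier
    d = τ + - σ

  coincide∧a₁≈a₂⇒x₁≈x₂ : ∀ {σ x₁ x₂ a₁ a₂} →
    a₁ ≈ᴹ a₂ → x₁ +ᴹ σ *ₗ a₁ ≈ᴹ x₂ +ᴹ σ *ₗ a₂ → x₁ ≈ᴹ x₂
  coincide∧a₁≈a₂⇒x₁≈x₂ a₁≈a₂ coincide =
    ∙-cancelʳ _ _ _ (≈ᴹ-trans coincide (+ᴹ-congˡ (*ₗ-cong S.refl (≈ᴹ-sym a₁≈a₂))))

module HypergraphProperties {s ℓs c ℓ : Level} (S : Ring s ℓs) (R : Ring c ℓ)
  (_*ₗ_ : Ring.Carrier S → Ring.Carrier R → Ring.Carrier R)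
  (isModule : IsLeftModule S (Ring._≈_ R) (Ring._+_ R) (Ring.0# R) (Ring.-_ R) _*ₗ_)
  (r : ℕ) (lam : Fin r → Ring.Carrier S)
  (R' A : List (Ring.Carrier R)) where

  open Ring R using (_≈_; _+_; +-cong; trans; sym)
  open Hypergraph S R _*ₗ_ r lam R' A
  open IsLeftModule isModule using (*ₗ-cong)

  R-as-module : LeftModule S c ℓ
  R-as-module = record { isLeftModule = isModule }

  same-part⇒≈V : ∀ {x a y₁ y₂ i} →
    (y₁ , i) ∈e[ x , a ] → (y₂ , i) ∈e[ x , a ] → (y₁ , i) ≈V (y₂ , i)
  same-part⇒≈V y₁∈e y₂∈e = trans y₁∈e (sym y₂∈e) , refl

  ≈⇒SameEdge : ∀ {x₁ a₁ x₂ a₂} → x₁ ≈ x₂ → a₁ ≈ a₂ → SameEdge x₁ a₁ x₂ a₂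
  ≈⇒SameEdge {x₁} {a₁} {x₂} {a₂} x₁≈x₂ a₁≈a₂ (_ , i) =
    mk⇔ (λ y∈e₁ → trans y∈e₁ e₁≈e₂) (λ y∈e₂ → trans y∈e₂ (sym e₁≈e₂))
    where
    e₁≈e₂ : x₁ + lam i *ₗ a₁ ≈ x₂ + lam i *ₗ a₂
    e₁≈e₂ = +-cong x₁≈x₂ (*ₗ-cong (Ring.refl S) a₁≈a₂)

proposition2p2 : {s ℓs c ℓ : Level} (S : Ring s ℓs) (R : Ring c ℓ)
    (_*ₗ_ : Ring.Carrier S → Ring.Carrier R → Ring.Carrier R)
    (isModule : IsLeftModule S (Ring._≈_ R) (Ring._+_ R) (Ring.0# R) (Ring.-_ R) _*ₗ_)
    (r : ℕ) → r ≥ 2 → (lam : Fin r → Ring.Carrier S)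
    (R' A : List (Ring.Carrier R)) →
    (∀ (i₁ i₂ : Fin r) → ¬ (i₁ ≡ i₂) →
      ∀ a₁ a₂ → SetoidMembership._∈_ (Ring.setoid R) a₁ A → SetoidMembership._∈_ (Ring.setoid R) a₂ A →
      Ring._≈_ R (_*ₗ_ (Ring._+_ S (lam i₂) (Ring.-_ S (lam i₁))) a₁)
                 (_*ₗ_ (Ring._+_ S (lam i₂) (Ring.-_ S (lam i₁))) a₂) →
      Ring._≈_ R a₁ a₂) →
    Hypergraph.HasNoBerge2Cycle S R _*ₗ_ r lam R' A
proposition2p2 S R _*ₗ_ isModule r _ lam R' A injective
  (x₁ , a₁ , x₂ , a₂ , _ , a₁∈A , _ , a₂∈A , distinct-edges ,
   (y₁ , i₁) , (y₂ , i₂) , distinct-vertices , v₁∈E₁ , v₂∈E₁ , v₁∈E₂ , v₂∈E₂)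
  with i₁ ≟ i₂
... | yes refl = distinct-vertices (same-part⇒≈V v₁∈E₁ v₂∈E₁)
  where open HypergraphProperties S R _*ₗ_ isModule r lam R' A
... | no i₁≢i₂ = distinct-edges (≈⇒SameEdge x₁≈x₂ a₁≈a₂)
  where
  open HypergraphProperties S R _*ₗ_ isModule r lam R' A
  open Ring R using (_≈_; _+_; trans; sym)
  meet₁ : x₁ + lam i₁ *ₗ a₁ ≈ x₂ + lam i₁ *ₗ a₂
  meet₁ = trans (sym v₁∈E₁) v₁∈E₂
  meet₂ : x₁ + lam i₂ *ₗ a₁ ≈ x₂ + lam i₂ *ₗ a₂
  meet₂ = trans (sym v₂∈E₁) v₂∈E₂
  a₁≈a₂ : a₁ ≈ a₂
  a₁≈a₂ = injective i₁ i₂ i₁≢i₂ a₁ a₂ a₁∈A a₂∈A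
            (coincide-twice⇒[τ-σ]a₁≈[τ-σ]a₂ R-as-module meet₁ meet₂)
  x₁≈x₂ : x₁ ≈ x₂
  x₁≈x₂ = coincide∧a₁≈a₂⇒x₁≈x₂ R-as-module a₁≈a₂ meet₁
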